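{- For every set $\Phi\cup\{\varphi\}\subseteq Fm_e$: $\Phi\vdash_{IEL}\varphi$ if and only if $\square\Phi\vdash_{EL5^*}\square\varphi$, where $\square\Phi:=\{\square\psi:\psi\in\Phi\}$.
   Context: Formulas $Fm$ are built from an infinite set of variables using $\bot,\wedge,\vee,\rightarrow$ and unary $\square,K$; $Fm_e\subseteq Fm$ is the set of formulas not containing $\square$. $\neg\varphi:=\varphi\rightarrow\bot$. $IEL$ is the system over $Fm_e$ with axiom schemes: all theorems of intuitionistic propositional logic and their substitution-instances (in $Fm_e$); $K(\varphi\rightarrow\psi)\rightarrow(K\varphi\rightarrow K\psi)$; $\varphi\rightarrow K\varphi$; $K\varphi\rightarrow\neg\neg\varphi$; with Modus Ponens as only rule; $\Phi\vdash_{IEL}\varphi$ is derivability from premises $\Phi$ in the usual sense. $EL5^*$ is the system over $Fm$ with axiom schemes: (INT) all theorems of intuitionistic propositional logic and their substitution-instances in $Fm$; $\square(\varphi\vee\psi)\rightarrow(\square\varphi\vee\square\psi)$; $\square\varphi\rightarrow\varphi$; $\square(\varphi\rightarrow\psi)\rightarrow\square(\square\varphi\rightarrow\square\psi)$; $\square\varphi\rightarrow\square\square\varphi$; $\neg\square\varphi\rightarrow\square\neg\square\varphi$; $\varphi\rightarrow K\varphi$; $K\varphi\rightarrow\neg\neg\varphi$; $K(\varphi\rightarrow\psi)\rightarrow(K\varphi\rightarrow K\psi)$; theorem scheme (TND) $\varphi\vee\neg\varphi$; rules Modus Ponens and Axiom Necessitation (if $\varphi$ is an axiom of $EL5^*$,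 infer $\square\varphi$; not applicable to instances of (TND) or other theorems). $\Phi\vdash_{EL5^*}\varphi$ means there is a finite sequence ending in $\varphi$ whose members are axioms, members of $\Phi$, instances of (TND), formulas $\square\psi$ with $\psi$ an axiom, or obtained by Modus Ponens from earlier members. -}

module Defs where

open import Data.Nat using (ℕ)
open import Data.Product using (Σ; _×_)
open import Relation.Binary.PropositionalEquality using (_≡_)

infixr 6 _∧_
infixr 5 _∨_
infixr 4 _⇒_

data Fm : Set where
  var : ℕ → Fm
  ⊥'  : Fm
  _∧_ : Fm → Fm → Fm
  _∨_ : Fm → Fm → Fm
  _⇒_ : Fm → Fm → Fm
  □   : Fm → Fm
  K   : Fm → Fm

¬' : Fm → Fm
¬' φ = φ ⇒ ⊥'

data BoxFree : Fm → Set where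
  var : ∀ n → BoxFree (var n)
  ⊥'  : BoxFree ⊥'
  _∧_ : ∀ {φ ψ} → BoxFree φ → BoxFree ψ → BoxFree (φ ∧ ψ)
  _∨_ : ∀ {φ ψ} → BoxFree φ → BoxFree ψ → BoxFree (φ ∨ ψ)
  _⇒_ : ∀ {φ ψ} → BoxFree φ → BoxFree ψ → BoxFree (φ ⇒ ψ)
  K   : ∀ {φ} → BoxFree φ → BoxFree (K φ)

-- Substitution instances (in Fm) of theorems of intuitionistic propositional
-- logic: derivable in a standard Hilbert calculus for IPC whose schemes range
-- over all of Fm (□φ, Kφ treated as atoms), with modus ponens.
data IntThm : Fm → Set where
  k    : ∀ A B → IntThm (A ⇒ B ⇒ A)
  s    : ∀ A B C → IntThm ((A ⇒ B ⇒ C) ⇒ (A ⇒ B) ⇒ A ⇒ C)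
  ∧e₁  : ∀ A B → IntThm (A ∧ B ⇒ A)
  ∧e₂  : ∀ A B → IntThm (A ∧ B ⇒ B)
  ∧i   : ∀ A B → IntThm (A ⇒ B ⇒ A ∧ B)
  ∨i₁  : ∀ A B → IntThm (A ⇒ A ∨ B)
  ∨i₂  : ∀ A B → IntThm (B ⇒ A ∨ B)
  ∨e   : ∀ A B C → IntThm ((A ⇒ C) ⇒ (B ⇒ C) ⇒ A ∨ B ⇒ C)
  efq  : ∀ A → IntThm (⊥' ⇒ A)
  mp   : ∀ {A B} → IntThm (A ⇒ B) → IntThm A → IntThm B

data IELAx : Fm → Set where
  int  : ∀ {φ} → IntThm φ → BoxFree φ → IELAx φ
  kK   : ∀ φ ψ → IELAx (K (φ ⇒ ψ) ⇒ K φ ⇒ K ψ)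
  co   : ∀ φ → IELAx (φ ⇒ K φ)
  refl : ∀ φ → IELAx (K φ ⇒ ¬' (¬' φ))

data _⊢IEL_ (Φ : Fm → Set) : Fm → Set where
  ax   : ∀ {φ} → IELAx φ → Φ ⊢IEL φ
  prem : ∀ {φ} → Φ φ → Φ ⊢IEL φ
  mp   : ∀ {φ ψ} → Φ ⊢IEL (φ ⇒ ψ) → Φ ⊢IEL φ → Φ ⊢IEL ψ

-- Axioms of EL5* (over Fm); (TND) is not an axiom
data EL5Ax : Fm → Set where
  int   : ∀ {φ} → IntThm φ → EL5Ax φ
  □∨    : ∀ φ ψ → EL5Ax (□ (φ ∨ ψ) ⇒ □ φ ∨ □ ψ)
  □T    : ∀ φ → EL5Ax (□ φ ⇒ φ)
  □K    : ∀ φ ψ → EL5Ax (□ (φ ⇒ ψ) ⇒ □ (□ φ ⇒ □ ψ))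
  □4    : ∀ φ → EL5Ax (□ φ ⇒ □ (□ φ))
  □5    : ∀ φ → EL5Ax (¬' (□ φ) ⇒ □ (¬' (□ φ)))
  co    : ∀ φ → EL5Ax (φ ⇒ K φ)
  refl  : ∀ φ → EL5Ax (K φ ⇒ ¬' (¬' φ))
  kK    : ∀ φ ψ → EL5Ax (K (φ ⇒ ψ) ⇒ K φ ⇒ K ψ)

data _⊢EL5*_ (Φ : Fm → Set) : Fm → Set where
  ax   : ∀ {φ} → EL5Ax φ → Φ ⊢EL5* φ
  prem : ∀ {φ} → Φ φ → Φ ⊢EL5* φ
  tnd  : ∀ φ → Φ ⊢EL5* (φ ∨ ¬' φ)
  nec  : ∀ {φ} → EL5Ax φ → Φ ⊢EL5* □ φ
  mp   : ∀ {φ ψ} → Φ ⊢EL5* (φ ⇒ ψ) → Φ ⊢EL5* φ → Φ ⊢EL5* ψ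

□Set : (Fm → Set) → (Fm → Set)
□Set Φ χ = Σ Fm (λ ψ → Φ ψ × (χ ≡ □ ψ))

-- Fix a valuation d : Fm → Bool and replace every outermost □a by ⊤ or ⊥ according to d a.
-- Relative to the goal φ, assume the translation t of a when d a = true and t → φ otherwise.
-- Under these assumptions every translated EL5*-axiom is derivable in IEL or already yields φ,
-- and a translated proof of □φ ends in ⊤ or in ⊥; in the latter case the instances of TND it
-- uses are eliminated by Glivenko's theorem, ⊥ being negative.  So φ follows for every d, and
-- the assumptions are then discharged one formula at a time, largest first, by the case split
-- on t versus t → φ, which changes d at that formula only.
module Submission where

open import Defs
open import Data.Bool using (Bool; true; false; if_then_else_)
open import Data.List using (List; []; _∷_; _++_)
open import Data.List.Membership.Propositional using (_∈_; _∉_)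
open import Data.List.Relation.Binary.Subset.Propositional using () renaming (_⊆_ to _⊆ₗ_)
open import Data.List.Relation.Unary.All using (All; []; _∷_)
import Data.List.Relation.Unary.All as All
open import Data.List.Relation.Unary.All.Properties using (++⁺; ++⁻ˡ; ++⁻ʳ)
open import Data.List.Relation.Unary.Any using (here; there)
import Data.Nat as ℕ
open import Data.Product using (Σ-syntax; ∃-syntax; _×_; _,_)
open import Data.Sum using (_⊎_; inj₁; inj₂; map₁)
open import Function.Base using (id; _∘_)
open import Function.Bundles using (_⇔_; mk⇔)
open import Level using (0ℓ)
open import Relation.Binary.Definitions using (DecidableEquality)
open import Relation.Binary.PropositionalEquality using (_≡_; refl; sym; cong; cong₂; subst)
open import Relation.Nullary.Decidable using (yes; no; does; dec-true; dec-false; map′; _×-dec_)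
open import Relation.Unary using (Pred; _⊆_; _∪_; ｛_｝)

infix 4 _≟_
_≟_ : DecidableEquality Fm
var m ≟ var n = map′ (cong var) (λ { refl → refl }) (m ℕ.≟ n)
⊥' ≟ ⊥' = yes refl
(a ∧ b) ≟ (c ∧ d) = map′ (λ { (refl , refl) → refl }) (λ { refl → refl , refl }) (a ≟ c ×-dec b ≟ d)
(a ∨ b) ≟ (c ∨ d) = map′ (λ { (refl , refl) → refl }) (λ { refl → refl , refl }) (a ≟ c ×-dec b ≟ d)
(a ⇒ b) ≟ (c ⇒ d) = map′ (λ { (refl , refl) → refl }) (λ { refl → refl , refl }) (a ≟ c ×-dec b ≟ d)
□ a ≟ □ c = map′ (cong □) (λ { refl → refl }) (a ≟ c)
K a ≟ K c = map′ (cong K) (λ { refl → refl }) (a ≟ c)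
var _ ≟ ⊥' = no λ ()
var _ ≟ (_ ∧ _) = no λ ()
var _ ≟ (_ ∨ _) = no λ ()
var _ ≟ (_ ⇒ _) = no λ ()
var _ ≟ □ _ = no λ ()
var _ ≟ K _ = no λ ()
⊥' ≟ var _ = no λ ()
⊥' ≟ (_ ∧ _) = no λ ()
⊥' ≟ (_ ∨ _) = no λ ()
⊥' ≟ (_ ⇒ _) = no λ ()
⊥' ≟ □ _ = no λ ()
⊥' ≟ K _ = no λ ()
(_ ∧ _) ≟ var _ = no λ ()
(_ ∧ _) ≟ ⊥' = no λ ()
(_ ∧ _) ≟ (_ ∨ _) = no λ ()
(_ ∧ _) ≟ (_ ⇒ _) = no λ ()
(_ ∧ _) ≟ □ _ = no λ ()
(_ ∧ _) ≟ K _ = no λ ()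
(_ ∨ _) ≟ var _ = no λ ()
(_ ∨ _) ≟ ⊥' = no λ ()
(_ ∨ _) ≟ (_ ∧ _) = no λ ()
(_ ∨ _) ≟ (_ ⇒ _) = no λ ()
(_ ∨ _) ≟ □ _ = no λ ()
(_ ∨ _) ≟ K _ = no λ ()
(_ ⇒ _) ≟ var _ = no λ ()
(_ ⇒ _) ≟ ⊥' = no λ ()
(_ ⇒ _) ≟ (_ ∧ _) = no λ ()
(_ ⇒ _) ≟ (_ ∨ _) = no λ ()
(_ ⇒ _) ≟ □ _ = no λ ()
(_ ⇒ _) ≟ K _ = no λ ()
□ _ ≟ var _ = no λ ()
□ _ ≟ ⊥' = no λ ()
□ _ ≟ (_ ∧ _) = no λ ()
□ _ ≟ (_ ∨ _) = no λ ()
□ _ ≟ (_ ⇒ _) = no λ ()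
□ _ ≟ K _ = no λ ()
K _ ≟ var _ = no λ ()
K _ ≟ ⊥' = no λ ()
K _ ≟ (_ ∧ _) = no λ ()
K _ ≟ (_ ∨ _) = no λ ()
K _ ≟ (_ ⇒ _) = no λ ()
K _ ≟ □ _ = no λ ()

open import Data.List.Membership.DecPropositional _≟_ using (_∈?_)


infix 3 _⊢_

-- IEL with its intuitionistic axioms ranging over all of Fm, so that the deduction theorem
-- holds without side conditions; translate maps it back into ⊢IEL.
data _⊢_ (T : Pred Fm 0ℓ) : Fm → Set where
  int  : ∀ {ψ} → IntThm ψ → T ⊢ ψ
  ax   : ∀ {ψ} → IELAx ψ → T ⊢ ψ
  prem : ∀ {ψ} → T ψ → T ⊢ ψ
  mp   : ∀ {ψ χ} → T ⊢ ψ ⇒ χ → T ⊢ ψ → T ⊢ χ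

⇒-refl-thm : ∀ A → IntThm (A ⇒ A)
⇒-refl-thm A = mp (mp (s A (A ⇒ A) A) (k A (A ⇒ A))) (k A A)

⊤' : Fm
⊤' = ⊥' ⇒ ⊥'

module _ {T : Pred Fm 0ℓ} where

  ⊢-mono : ∀ {U ψ} → T ⊆ U → T ⊢ ψ → U ⊢ ψ
  ⊢-mono _   (int t)  = int t
  ⊢-mono _   (ax a)   = ax a
  ⊢-mono T⊆U (prem p) = prem (T⊆U p)
  ⊢-mono T⊆U (mp f x) = mp (⊢-mono T⊆U f) (⊢-mono T⊆U x)

  weaken : ∀ {a ψ} → T ⊢ ψ → T ∪ ｛ a ｝ ⊢ ψ
  weaken = ⊢-mono inj₁

  hyp : ∀ {a} → T ∪ ｛ a ｝ ⊢ a
  hyp = prem (inj₂ refl)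

  ⇒-refl : ∀ {a} → T ⊢ a ⇒ a
  ⇒-refl = int (⇒-refl-thm _)

  ⊤-intro : T ⊢ ⊤'
  ⊤-intro = ⇒-refl

  ⇒-const : ∀ {a ψ} → T ⊢ ψ → T ⊢ a ⇒ ψ
  ⇒-const p = mp (int (k _ _)) p

  ⇒-ap : ∀ {a b c} → T ⊢ a ⇒ b ⇒ c → T ⊢ a ⇒ b → T ⊢ a ⇒ c
  ⇒-ap f x = mp (mp (int (s _ _ _)) f) x

  ⊥-elim : ∀ {ψ} → T ⊢ ⊥' → T ⊢ ψ
  ⊥-elim = mp (int (efq _))

  ∨-introˡ : ∀ {a b} → T ⊢ a → T ⊢ a ∨ b
  ∨-introˡ = mp (int (∨i₁ _ _))

  ∨-introʳ : ∀ {a b} → T ⊢ b → T ⊢ a ∨ b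
  ∨-introʳ = mp (int (∨i₂ _ _))

  ∨-elim : ∀ {a b c} → T ⊢ a ⇒ c → T ⊢ b ⇒ c → T ⊢ a ∨ b → T ⊢ c
  ∨-elim f g x = mp (mp (mp (int (∨e _ _ _)) f) g) x

deduction : ∀ {T a ψ} → T ∪ ｛ a ｝ ⊢ ψ → T ⊢ a ⇒ ψ
deduction (int t)            = ⇒-const (int t)
deduction (ax x)             = ⇒-const (ax x)
deduction (prem (inj₁ p))    = ⇒-const (prem p)
deduction (prem (inj₂ refl)) = ⇒-refl
deduction (mp f x)           = ⇒-ap (deduction f) (deduction x)

by-cases : ∀ {T t φ} → T ∪ ｛ t ｝ ⊢ φ → T ∪ ｛ t ⇒ φ ｝ ⊢ φ → T ⊢ φ
by-cases if-t if-¬t = mp (deduction if-¬t) (deduction if-t)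

Excluded-middle : Pred Fm 0ℓ
Excluded-middle χ = ∃[ t ] χ ≡ t ∨ ¬' t

module _ {T : Pred Fm 0ℓ} where

  ¬¬-intro : ∀ {ψ} → T ⊢ ψ → T ⊢ ¬' (¬' ψ)
  ¬¬-intro p = deduction (mp hyp (weaken p))

  ¬¬-excluded-middle : ∀ {t} → T ⊢ ¬' (¬' (t ∨ ¬' t))
  ¬¬-excluded-middle = deduction (mp hyp (∨-introʳ (deduction (mp (weaken hyp) (∨-introˡ hyp)))))

  ¬¬-mp : ∀ {a b} → T ⊢ ¬' (¬' (a ⇒ b)) → T ⊢ ¬' (¬' a) → T ⊢ ¬' (¬' b)
  ¬¬-mp f x =
    deduction (mp (weaken x) (deduction (mp (weaken (weaken f))
      (deduction (mp (weaken (weaken hyp)) (mp hyp (weaken hyp)))))))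

glivenko : ∀ {T ψ} → T ∪ Excluded-middle ⊢ ψ → T ⊢ ¬' (¬' ψ)
glivenko (int t)                  = ¬¬-intro (int t)
glivenko (ax x)                   = ¬¬-intro (ax x)
glivenko (prem (inj₁ p))          = ¬¬-intro (prem p)
glivenko (prem (inj₂ (_ , refl))) = ¬¬-excluded-middle
glivenko (mp f x)                 = ¬¬-mp (glivenko f) (glivenko x)

excluded-middle-⊥-conservative : ∀ {T} → T ∪ Excluded-middle ⊢ ⊥' → T ⊢ ⊥'
excluded-middle-⊥-conservative p = mp (glivenko p) ⊤-intro

⌜_⌝ : Bool → Fm
⌜ true ⌝  = ⊤'
⌜ false ⌝ = ⊥'

translate : (Fm → Bool) → Fm → Fm
translate d (var n) = var n
translate d ⊥'      = ⊥'
translate d (a ∧ b) = translate d a ∧ translate d b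
translate d (a ∨ b) = translate d a ∨ translate d b
translate d (a ⇒ b) = translate d a ⇒ translate d b
translate d (□ a)   = ⌜ d a ⌝
translate d (K a)   = K (translate d a)

boxArgs : Fm → List Fm
boxArgs (var n) = []
boxArgs ⊥'      = []
boxArgs (a ∧ b) = boxArgs a ++ boxArgs b
boxArgs (a ∨ b) = boxArgs a ++ boxArgs b
boxArgs (a ⇒ b) = boxArgs a ++ boxArgs b
boxArgs (□ a)   = a ∷ []
boxArgs (K a)   = boxArgs a

translate-intThm : ∀ d {θ} → IntThm θ → IntThm (translate d θ)
translate-intThm d (k _ _)    = k _ _
translate-intThm d (s _ _ _)  = s _ _ _
translate-intThm d (∧e₁ _ _)  = ∧e₁ _ _
translate-intThm d (∧e₂ _ _)  = ∧e₂ _ _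
translate-intThm d (∧i _ _)   = ∧i _ _
translate-intThm d (∨i₁ _ _)  = ∨i₁ _ _
translate-intThm d (∨i₂ _ _)  = ∨i₂ _ _
translate-intThm d (∨e _ _ _) = ∨e _ _ _
translate-intThm d (efq _)    = efq _
translate-intThm d (mp f x)   = mp (translate-intThm d f) (translate-intThm d x)

⌜⌝-boxFree : ∀ b → BoxFree ⌜ b ⌝
⌜⌝-boxFree true  = ⊥' ⇒ ⊥'
⌜⌝-boxFree false = ⊥'

translate-boxFree : ∀ d θ → BoxFree (translate d θ)
translate-boxFree d (var n) = var n
translate-boxFree d ⊥'      = ⊥'
translate-boxFree d (a ∧ b) = translate-boxFree d a ∧ translate-boxFree d b
translate-boxFree d (a ∨ b) = translate-boxFree d a ∨ translate-boxFree d b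
translate-boxFree d (a ⇒ b) = translate-boxFree d a ⇒ translate-boxFree d b
translate-boxFree d (□ a)   = ⌜⌝-boxFree (d a)
translate-boxFree d (K a)   = K (translate-boxFree d a)

translate-id : ∀ d {θ} → BoxFree θ → translate d θ ≡ θ
translate-id d (var n) = refl
translate-id d ⊥'      = refl
translate-id d (a ∧ b) = cong₂ _∧_ (translate-id d a) (translate-id d b)
translate-id d (a ∨ b) = cong₂ _∨_ (translate-id d a) (translate-id d b)
translate-id d (a ⇒ b) = cong₂ _⇒_ (translate-id d a) (translate-id d b)
translate-id d (K a)   = cong K (translate-id d a)

translate-cong : ∀ {d d'} θ → All (λ a → d a ≡ d' a) (boxArgs θ) → translate d θ ≡ translate d' θ
translate-cong (var n) _ = refl
translate-cong ⊥'      _ = refl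
translate-cong (a ∧ b) eq = cong₂ _∧_ (translate-cong a (++⁻ˡ _ eq)) (translate-cong b (++⁻ʳ _ eq))
translate-cong (a ∨ b) eq = cong₂ _∨_ (translate-cong a (++⁻ˡ _ eq)) (translate-cong b (++⁻ʳ _ eq))
translate-cong (a ⇒ b) eq = cong₂ _⇒_ (translate-cong a (++⁻ˡ _ eq)) (translate-cong b (++⁻ʳ _ eq))
translate-cong (□ a)   (eq ∷ []) = cong ⌜_⌝ eq
translate-cong (K a)   eq = cong K (translate-cong a eq)

⊢⇒⊢IEL : ∀ {Φ} d → (∀ ψ → Φ ψ → BoxFree ψ) → ∀ {ψ} → Φ ⊢ ψ → Φ ⊢IEL translate d ψ
⊢⇒⊢IEL d bf {ψ} (int t)       = ax (int (translate-intThm d t) (translate-boxFree d ψ))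
⊢⇒⊢IEL d bf {ψ} (ax (int t _)) = ax (int (translate-intThm d t) (translate-boxFree d ψ))
⊢⇒⊢IEL d bf (ax (kK a b))     = ax (kK _ _)
⊢⇒⊢IEL d bf (ax (co a))       = ax (co _)
⊢⇒⊢IEL d bf (ax (refl a))     = ax (refl _)
⊢⇒⊢IEL d bf (prem {ψ} p)      = subst (_ ⊢IEL_) (sym (translate-id d (bf ψ p))) (prem p)
⊢⇒⊢IEL d bf (mp f x)          = mp (⊢⇒⊢IEL d bf f) (⊢⇒⊢IEL d bf x)

assume : Fm → Bool → Fm → Fm
assume φ true  t = t
assume φ false t = t ⇒ φ

Assumptions : Fm → (Fm → Bool) → List Fm → Pred Fm 0ℓ
Assumptions φ d P χ = ∃[ x ] (x ∈ P × χ ≡ assume φ (d x) (translate d x))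

update : (Fm → Bool) → Fm → Bool → Fm → Bool
update d c b x = if does (x ≟ c) then b else d x

update-same : ∀ d c b → update d c b c ≡ b
update-same d c b rewrite dec-true (c ≟ c) refl = refl

update-other : ∀ d {c P x} b → c ∉ P → x ∈ P → update d c b x ≡ d x
update-other d {c} {x = x} b c∉P x∈P rewrite dec-false (x ≟ c) (λ { refl → c∉P x∈P }) = refl

Covers : List Fm → Fm → Set
Covers P θ = All (_∈ P) (boxArgs θ)

-- Every formula occurs once and in front of its box arguments, so the translations of the
-- tail do not depend on d at the head.
data Stratified : List Fm → Set where
  []     : Stratified []
  extend : ∀ {c P} → c ∉ P → Covers P c → Stratified P → Stratified (c ∷ P)

stratified-covers : ∀ {P x} → Stratified P → x ∈ P → Covers P x
stratified-covers (extend _ cov _) (here refl) = All.map there cov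
stratified-covers (extend _ _ strat) (there x∈P) = All.map there (stratified-covers strat x∈P)

translate-update : ∀ d {c P} b x → c ∉ P → Covers P x → translate (update d c b) x ≡ translate d x
translate-update d b x c∉P cov = translate-cong x (All.map (update-other d b c∉P) cov)

assumptions-update : ∀ {Φ : Pred Fm 0ℓ} {φ d c P} b → c ∉ P → Covers P c → Stratified P →
  Φ ∪ Assumptions φ (update d c b) (c ∷ P) ⊆ (Φ ∪ Assumptions φ d P) ∪ ｛ assume φ b (translate d c) ｝
assumptions-update b c∉P cov strat (inj₁ p) = inj₁ (inj₁ p)
assumptions-update {φ = φ} {d} {c} b c∉P cov strat (inj₂ (_ , here refl , refl)) =
  inj₂ (cong₂ (assume φ) (sym (update-same d c b)) (sym (translate-update d b c c∉P cov)))
assumptions-update {φ = φ} {d} b c∉P cov strat (inj₂ (x , there x∈P , refl)) =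
  inj₁ (inj₂ (x , x∈P , cong₂ (assume φ) (update-other d b c∉P x∈P)
                                        (translate-update d b x c∉P (stratified-covers strat x∈P))))

discharge : ∀ {Φ : Pred Fm 0ℓ} {φ P} → Stratified P → (∀ d → Φ ∪ Assumptions φ d P ⊢ φ) → Φ ⊢ φ
discharge [] h = ⊢-mono (λ { (inj₁ p) → p ; (inj₂ (_ , () , _)) }) (h (λ _ → true))
discharge {Φ} (extend {c} c∉P cov strat) h = discharge strat λ d →
  by-cases (⊢-mono (assumptions-update {Φ} true c∉P cov strat) (h (update d c true)))
           (⊢-mono (assumptions-update {Φ} false c∉P cov strat) (h (update d c false)))

Extension : List Fm → (List Fm → Set) → Set
Extension P Q = Σ[ P' ∈ List Fm ] (Stratified P' × P ⊆ₗ P' × Q P')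

mutual
  insert : ∀ a {P} → Stratified P → Extension P (a ∈_)
  insert a strat with insertBoxArgs a strat
  ... | P' , strat' , P⊆P' , cov with a ∈? P'
  ...   | yes a∈P' = P' , strat' , P⊆P' , a∈P'
  ...   | no  a∉P' = a ∷ P' , extend a∉P' cov strat' , there ∘ P⊆P' , here refl

  insertBoxArgs : ∀ θ {P} → Stratified P → Extension P (λ P' → Covers P' θ)
  insertBoxArgs (var n) strat = _ , strat , id , []
  insertBoxArgs ⊥'      strat = _ , strat , id , []
  insertBoxArgs (a ∧ b) strat = insertBoxArgs₂ a b strat
  insertBoxArgs (a ∨ b) strat = insertBoxArgs₂ a b strat
  insertBoxArgs (a ⇒ b) strat = insertBoxArgs₂ a b strat
  insertBoxArgs (□ a)   strat with insert a strat
  ... | P' , strat' , P⊆P' , a∈P' = P' , strat' , P⊆P' , a∈P' ∷ []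
  insertBoxArgs (K a)   strat = insertBoxArgs a strat

  insertBoxArgs₂ : ∀ a b {P} → Stratified P → Extension P (λ P' → All (_∈ P') (boxArgs a ++ boxArgs b))
  insertBoxArgs₂ a b strat with insertBoxArgs a strat
  ... | P₁ , strat₁ , P⊆P₁ , cov₁ with insertBoxArgs b strat₁
  ...   | P₂ , strat₂ , P₁⊆P₂ , cov₂ =
    P₂ , strat₂ , P₁⊆P₂ ∘ P⊆P₁ , ++⁺ (All.map P₁⊆P₂ cov₁) cov₂

cover : (L : List Fm) → Σ[ P ∈ List Fm ] (Stratified P × All (Covers P) L)
cover [] = [] , [] , []
cover (θ ∷ L) with cover L
... | P , strat , covL with insertBoxArgs θ strat
...   | P' , strat' , P⊆P' , covθ = P' , strat' , covθ ∷ All.map (All.map P⊆P') covL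

leaves : ∀ {Γ θ} → Γ ⊢EL5* θ → List Fm
leaves (mp D E)   = leaves D ++ leaves E
leaves {θ = θ} _  = θ ∷ []

module _ {T : Pred Fm 0ℓ} {φ : Fm} where

  □T-sound : ∀ δ {t} → T ⊢ assume φ δ t → T ⊢ ⌜ δ ⌝ ⇒ t
  □T-sound true  t = ⇒-const t
  □T-sound false _ = int (efq _)

  □∨-sound : ∀ δ δa δb {ta tb} →
    T ⊢ assume φ δ (ta ∨ tb) → T ⊢ assume φ δa ta → T ⊢ assume φ δb tb →
    T ⊢ ⌜ δ ⌝ ⇒ ⌜ δa ⌝ ∨ ⌜ δb ⌝ ⊎ T ⊢ φ
  □∨-sound false _     _     _  _  _  = inj₁ (int (efq _))
  □∨-sound true  true  _     _  _  _  = inj₁ (⇒-const (∨-introˡ ⊤-intro))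
  □∨-sound true  false true  _  _  _  = inj₁ (⇒-const (∨-introʳ ⊤-intro))
  □∨-sound true  false false ab ¬a ¬b = inj₂ (∨-elim ¬a ¬b ab)

  □K-sound : ∀ δ γ δa δb {ta tb} →
    T ⊢ assume φ δ (ta ⇒ tb) → T ⊢ assume φ γ (⌜ δa ⌝ ⇒ ⌜ δb ⌝) →
    T ⊢ assume φ δa ta → T ⊢ assume φ δb tb →
    T ⊢ ⌜ δ ⌝ ⇒ ⌜ γ ⌝ ⊎ T ⊢ φ
  □K-sound false _     _     _     _ _  _ _  = inj₁ (int (efq _))
  □K-sound true  true  _     _     _ _  _ _  = inj₁ (⇒-const ⊤-intro)
  □K-sound true  false false _     _ ¬g _ _  = inj₂ (mp ¬g (int (efq _)))
  □K-sound true  false true  true  _ ¬g _ _  = inj₂ (mp ¬g (⇒-const ⊤-intro))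
  □K-sound true  false true  false f _  a ¬b = inj₂ (mp ¬b (mp f a))

  □4-sound : ∀ δ γ → T ⊢ assume φ γ ⌜ δ ⌝ → T ⊢ ⌜ δ ⌝ ⇒ ⌜ γ ⌝ ⊎ T ⊢ φ
  □4-sound false _     _  = inj₁ (int (efq _))
  □4-sound true  true  _  = inj₁ (⇒-const ⊤-intro)
  □4-sound true  false ¬g = inj₂ (mp ¬g ⊤-intro)

  □5-sound : ∀ δ γ → T ⊢ assume φ γ (¬' ⌜ δ ⌝) → T ⊢ ¬' ⌜ δ ⌝ ⇒ ⌜ γ ⌝ ⊎ T ⊢ φ
  □5-sound true  _     _  = inj₁ (deduction (⊥-elim (mp hyp ⊤-intro)))
  □5-sound false true  _  = inj₁ (⇒-const ⊤-intro)
  □5-sound false false ¬g = inj₂ (mp ¬g ⊤-intro)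

  □-intro-sound : ∀ δ {t} → T ⊢ assume φ δ t → T ⊢ t ⊎ T ⊢ φ → T ⊢ ⌜ δ ⌝ ⊎ T ⊢ φ
  □-intro-sound true  _  _         = inj₁ ⊤-intro
  □-intro-sound false ¬t (inj₁ t)  = inj₂ (mp ¬t t)
  □-intro-sound false _  (inj₂ g)  = inj₂ g

  goal-reached : ∀ δ → T ⊢ assume φ δ φ → T ∪ Excluded-middle ⊢ ⌜ δ ⌝ ⊎ T ⊢ φ → T ⊢ φ
  goal-reached true  g _         = g
  goal-reached false _ (inj₁ ⊥)  = ⊥-elim (excluded-middle-⊥-conservative ⊥)
  goal-reached false _ (inj₂ g)  = g

mp⊎ : ∀ {T a b} {G : Set} → T ⊢ a ⇒ b ⊎ G → T ⊢ a ⊎ G → T ⊢ b ⊎ G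
mp⊎ (inj₁ f) (inj₁ x) = inj₁ (mp f x)
mp⊎ (inj₁ _) (inj₂ g) = inj₂ g
mp⊎ (inj₂ g) _        = inj₂ g

module Soundness (Φ : Pred Fm 0ℓ) (Φ-boxFree : ∀ ψ → Φ ψ → BoxFree ψ) (φ : Fm)
                 (d : Fm → Bool) {P : List Fm} (strat : Stratified P) where

  H : Pred Fm 0ℓ
  H = Φ ∪ Assumptions φ d P

  settled : ∀ {x} → x ∈ P → H ⊢ assume φ (d x) (translate d x)
  settled {x} x∈P = prem (inj₂ (x , x∈P , refl))

  axiom-sound : ∀ {θ} → EL5Ax θ → Covers P θ → H ⊢ translate d θ ⊎ H ⊢ φ
  axiom-sound (int t)  _ = inj₁ (int (translate-intThm d t))
  axiom-sound (co _)   _ = inj₁ (ax (co _))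
  axiom-sound (refl _) _ = inj₁ (ax (refl _))
  axiom-sound (kK _ _) _ = inj₁ (ax (kK _ _))
  axiom-sound (□T c) (c∈P ∷ _) = inj₁ (□T-sound (d c) (settled c∈P))
  axiom-sound (□∨ a b) (ab∈P ∷ a∈P ∷ b∈P ∷ []) =
    □∨-sound (d (a ∨ b)) (d a) (d b) (settled ab∈P) (settled a∈P) (settled b∈P)
  axiom-sound (□K a b) (ab∈P ∷ ab□∈P ∷ []) with stratified-covers strat ab□∈P
  ... | a∈P ∷ b∈P ∷ [] =
    □K-sound (d (a ⇒ b)) (d (□ a ⇒ □ b)) (d a) (d b)
             (settled ab∈P) (settled ab□∈P) (settled a∈P) (settled b∈P)
  axiom-sound (□4 c) (_ ∷ c□∈P ∷ []) = □4-sound (d c) (d (□ c)) (settled c□∈P)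
  axiom-sound (□5 c) (_ ∷ c¬□∈P ∷ []) = □5-sound (d c) (d (¬' (□ c))) (settled c¬□∈P)

  sound : ∀ {θ} (D : □Set Φ ⊢EL5* θ) → All (Covers P) (leaves D) →
          H ∪ Excluded-middle ⊢ translate d θ ⊎ H ⊢ φ
  sound (ax x) (cov ∷ []) = map₁ (⊢-mono inj₁) (axiom-sound x cov)
  sound (prem (ψ , ψ∈Φ , refl)) ((ψ∈P ∷ []) ∷ []) =
    map₁ (⊢-mono inj₁) (□-intro-sound (d ψ) (settled ψ∈P)
      (inj₁ (subst (H ⊢_) (sym (translate-id d (Φ-boxFree ψ ψ∈Φ))) (prem (inj₁ ψ∈Φ)))))
  sound (tnd θ) _ = inj₁ (prem (inj₂ (translate d θ , refl)))
  sound (nec {θ} x) ((θ∈P ∷ []) ∷ []) =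
    map₁ (⊢-mono inj₁) (□-intro-sound (d θ) (settled θ∈P) (axiom-sound x (stratified-covers strat θ∈P)))
  sound (mp D E) cov = mp⊎ (sound D (++⁻ˡ (leaves D) cov)) (sound E (++⁻ʳ (leaves D) cov))

  goal : BoxFree φ → φ ∈ P → (D : □Set Φ ⊢EL5* □ φ) → All (Covers P) (leaves D) → H ⊢ φ
  goal φ-boxFree φ∈P D cov =
    goal-reached (d φ) (subst (λ t → H ⊢ assume φ (d φ) t) (translate-id d φ-boxFree) (settled φ∈P))
                 (sound D cov)

⊢IEL⇒⊢EL5*□ : ∀ {Φ φ} → Φ ⊢IEL φ → □Set Φ ⊢EL5* □ φ
⊢IEL⇒⊢EL5*□ (ax (int t _)) = nec (int t)
⊢IEL⇒⊢EL5*□ (ax (kK a b))  = nec (kK a b)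
⊢IEL⇒⊢EL5*□ (ax (co a))    = nec (co a)
⊢IEL⇒⊢EL5*□ (ax (refl a))  = nec (refl a)
⊢IEL⇒⊢EL5*□ (prem {φ} p)   = prem (φ , p , refl)
⊢IEL⇒⊢EL5*□ (mp f x)       = mp (mp (ax (□T _)) (mp (ax (□K _ _)) (⊢IEL⇒⊢EL5*□ f))) (⊢IEL⇒⊢EL5*□ x)

⊢EL5*□⇒⊢ : ∀ {Φ φ} → (∀ ψ → Φ ψ → BoxFree ψ) → BoxFree φ → □Set Φ ⊢EL5* □ φ → Φ ⊢ φ
⊢EL5*□⇒⊢ {Φ} {φ} Φ-boxFree φ-boxFree D with cover (□ φ ∷ leaves D)
... | P , strat , (φ∈P ∷ []) ∷ cov =
  discharge strat λ d → Soundness.goal Φ Φ-boxFree φ d strat φ-boxFree φ∈P D cov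

theorem6p1 : (Φ : Fm → Set) (φ : Fm) →
    (∀ ψ → Φ ψ → BoxFree ψ) → BoxFree φ →
    (Φ ⊢IEL φ) ⇔ (□Set Φ ⊢EL5* □ φ)
theorem6p1 Φ φ Φ-boxFree φ-boxFree = mk⇔ ⊢IEL⇒⊢EL5*□ λ D →
  subst (Φ ⊢IEL_) (translate-id _ φ-boxFree)
        (⊢⇒⊢IEL (λ _ → true) Φ-boxFree (⊢EL5*□⇒⊢ Φ-boxFree φ-boxFree D))
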